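{- (Upward derivability for the liability fragment of CCSR.) Let $\gamma$ be an elementary disjunction, $NI$ a finite index set, and for each $i\in NI$ let $A_i,B_i$ be coalitions and $\phi_i,\psi_i\in\Phi_{\mathsf{CCSR}_{LI}}$. Suppose that either $\vdash_{\mathsf{CCSR}_{LI}}\gamma$, or there are $NI_1,NI_2\subseteq NI$ with $(NI_1,NI_2)$ neat and $\vdash_{\mathsf{CCSR}_{LI}}\bigvee_{i\in NI_1}\phi_i\vee\bigvee_{i\in NI_2}(\phi_i\vee\psi_i)$. Then $\vdash_{\mathsf{CCSR}_{LI}}\gamma\vee\bigvee_{i\in NI}\mathsf C^d(A_i,\phi_i;B_i,\psi_i)$.
   Context: Fix a nonempty finite set $Ag$ of agents and a countable set $AP$ of atoms; a coalition is a subset of $Ag$. $\Phi_{\mathsf{CCSR}_{LI}}$: $\phi::=\top\mid\bot\mid p\mid\neg p\mid(\phi\wedge\phi)\mid(\phi\vee\phi)\mid\mathsf C^d(A,\phi;B,\phi)$ ($\mathsf C^d$ a formal binary-coalition operator). An elementary disjunction is a disjunction of literals; the empty disjunction is $\bot$. A pair $(NI_1,NI_2)$ of subsets of $NI$ is neat if: for distinct $i,i'\in NI_1$, $A_i\cap A_{i'}=\emptyset$; for distinct $i,i'\in NI_2$, $(A_i\cup B_i)\cap(A_{i'}\cup B_{i'})=\emptyset$; and for $i\in NI_1$, $i'\in NI_2$ with $i\neq i'$, $A_i\cap(A_{i'}\cup B_{i'})=\emptyset$. $\vdash_{\mathsf{CCSR}_{LI}}\phi$ means $\phi$ is derivable in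 the system whose axioms are the propositional tautologies in $\Phi_{\mathsf{CCSR}_{LI}}$ and whose rules are: R1: from $\phi_1,\dots,\phi_n$ infer $\psi$ where $(\phi_1\wedge\dots\wedge\phi_n)\to\psi$ is a propositional tautology; R2: from $\phi$ infer $\mathsf C^d(A,\phi;\emptyset,\bot)$; R3: from $\mathsf C^d(A\cup B,\phi\vee\psi;\emptyset,\bot)\vee\chi$ infer $\mathsf C^d(A,\phi;\emptyset,\bot)\vee\mathsf C^d(B,\psi;\emptyset,\bot)\vee\chi$, where $A\cap B=\emptyset$; R4: from $\mathsf C^d(A,\phi;\emptyset,\bot)\vee\chi$ infer $\mathsf C^d(A,\phi;B,\psi)\vee\chi$; R5: from $\mathsf C^d(A\cup B,\phi\vee\psi;\emptyset,\bot)\vee\chi$ infer $\mathsf C^d(A,\phi;B,\psi)\vee\chi$. -}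

module Defs where

open import Data.Bool using (Bool; true; false; _∧_; _∨_; not)
open import Data.Nat using (ℕ; suc)
open import Data.Fin using (Fin)
open import Data.Fin.Subset using (Subset; _∩_; _∪_; _∈_) renaming (⊥ to ∅)
open import Data.Fin.Subset.Properties using (_∈?_)
open import Data.List using (List; []; _∷_; _++_; map; filter)
open import Data.List.Relation.Unary.All using (All)
open import Data.Product using (_×_)
open import Relation.Binary.PropositionalEquality using (_≡_; _≢_)

-- Agents: a nonempty finite set, represented as Fin (suc k).
-- Coalitions: subsets of the agents.
Coalition : ℕ → Set
Coalition k = Subset (suc k)

data Fm (AP : Set) (k : ℕ) : Set where
  ⊤ᶠ ⊥ᶠ : Fm AP k
  atom  : AP → Fm AP k
  natom : AP → Fm AP k
  _∧ᶠ_ _∨ᶠ_ : Fm AP k → Fm AP k → Fm AP k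
  Cd    : Coalition k → Fm AP k → Coalition k → Fm AP k → Fm AP k

infixr 6 _∧ᶠ_
infixr 5 _∨ᶠ_

module _ {AP : Set} {k : ℕ} where

  -- Propositional valuation: atoms and (syntactic) C^d-formulas are treated
  -- as propositional variables.
  record Val : Set where
    field
      vatom : AP → Bool
      vC    : Coalition k → Fm AP k → Coalition k → Fm AP k → Bool
  open Val

  eval : Val → Fm AP k → Bool
  eval v ⊤ᶠ = true
  eval v ⊥ᶠ = false
  eval v (atom p) = vatom v p
  eval v (natom p) = not (vatom v p)
  eval v (φ ∧ᶠ ψ) = eval v φ ∧ eval v ψ
  eval v (φ ∨ᶠ ψ) = eval v φ ∨ eval v ψ
  eval v (Cd A φ B ψ) = vC v A φ B ψ

  Taut : Fm AP k → Set
  Taut φ = ∀ v → eval v φ ≡ true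

  TautImp : List (Fm AP k) → Fm AP k → Set
  TautImp Γ ψ = ∀ v → All (λ φ → eval v φ ≡ true) Γ → eval v ψ ≡ true

  data ⊢ : Fm AP k → Set where
    ax : ∀ {φ} → Taut φ → ⊢ φ
    R1 : ∀ (Γ : List (Fm AP k)) {ψ} → All ⊢ Γ → TautImp Γ ψ → ⊢ ψ
    R2 : ∀ {A φ} → ⊢ φ → ⊢ (Cd A φ ∅ ⊥ᶠ)
    R3 : ∀ {A B φ ψ χ} → A ∩ B ≡ ∅ →
         ⊢ (Cd (A ∪ B) (φ ∨ᶠ ψ) ∅ ⊥ᶠ ∨ᶠ χ) →
         ⊢ (Cd A φ ∅ ⊥ᶠ ∨ᶠ Cd B ψ ∅ ⊥ᶠ ∨ᶠ χ)
    R4 : ∀ {A B φ ψ χ} → ⊢ (Cd A φ ∅ ⊥ᶠ ∨ᶠ χ) → ⊢ (Cd A φ B ψ ∨ᶠ χ)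
    R5 : ∀ {A B φ ψ χ} → ⊢ (Cd (A ∪ B) (φ ∨ᶠ ψ) ∅ ⊥ᶠ ∨ᶠ χ) → ⊢ (Cd A φ B ψ ∨ᶠ χ)

  ⋁ : List (Fm AP k) → Fm AP k
  ⋁ [] = ⊥ᶠ
  ⋁ (φ ∷ []) = φ
  ⋁ (φ ∷ ψ ∷ rest) = φ ∨ᶠ ⋁ (ψ ∷ rest)

  lit : Bool × AP → Fm AP k
  lit (true Data.Product., p) = atom p
  lit (false Data.Product., p) = natom p

  elemDisj : List (Bool × AP) → Fm AP k
  elemDisj ls = ⋁ (map lit ls)

members : ∀ {m} → Subset m → List (Fin m)
members {m} S = filter (_∈? S) (Data.List.allFin m)

Neat : ∀ {k m} → (A B : Fin m → Coalition k) → (NI₁ NI₂ : Subset m) → Set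
Neat A B NI₁ NI₂ =
  (∀ i i' → i ∈ NI₁ → i' ∈ NI₁ → i ≢ i' → A i ∩ A i' ≡ ∅) ×
  (∀ i i' → i ∈ NI₂ → i' ∈ NI₂ → i ≢ i' → (A i ∪ B i) ∩ (A i' ∪ B i') ≡ ∅) ×
  (∀ i i' → i ∈ NI₁ → i' ∈ NI₂ → i ≢ i' → A i ∩ (A i' ∪ B i') ≡ ∅)

{-# OPTIONS --safe #-}
-- Merge NI₁ and NI₂ into one family indexed by NI₁ ∪ NI₂: index i contributes the
-- coalition A i ∪ B i and the claim φ i ∨ ψ i when i ∈ NI₂, and A i, φ i otherwise.
-- Neatness makes these coalitions pairwise disjoint, and the hypothesis propositionally
-- implies the disjunction of the claims. R2 turns that disjunction into
-- C^d(⋃ coalitions, ⋁ claims; ∅, ⊥); R3 splits it, one disjoint coalition at a time, into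
-- a disjunction of C^d(coalition i, claim i; ∅, ⊥), and R5 (for i ∈ NI₂) or R4 (otherwise)
-- restores each disjunct to C^d(A i, φ i; B i, ψ i). The case ⊢ γ is plain weakening.
module Submission where

open import Defs
open import Algebra.Bundles using (CommutativeMonoid)
open import Data.Bool using (Bool; true; false)
open import Data.Bool.Properties using (∨-identityʳ; ∨-zeroʳ; ∨-commutativeMonoid)
open import Data.Nat using (ℕ)
open import Data.Fin using (Fin)
open import Data.Fin.Subset using (Subset; _∈_; _∉_; _∩_; _∪_; ⋃) renaming (⊥ to ∅)
open import Data.Fin.Subset.Properties
  using (_∈?_; x∈p∪q⁺; x∈p∪q⁻; ∩-comm; ∩-zeroʳ; ∩-distribˡ-∪; ∪-identityʳ)
open import Data.List using (List; []; _∷_; _++_; map; allFin)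
open import Data.List.Relation.Unary.All using (All; []; _∷_)
import Data.List.Relation.Unary.All as All
import Data.List.Relation.Unary.All.Properties as All
open import Data.List.Relation.Unary.Any using (Any; here; there)
import Data.List.Relation.Unary.Any.Properties as Any
open import Data.List.Relation.Unary.AllPairs using (AllPairs; []; _∷_)
import Data.List.Relation.Unary.AllPairs.Properties as AllPairs
open import Data.List.Membership.Propositional using (find; lose) renaming (_∈_ to _∈ₗ_)
open import Data.List.Membership.Propositional.Properties using (∈-filter⁺; ∈-filter⁻; ∈-allFin)
open import Data.List.Relation.Binary.Subset.Propositional using (_⊆_)
open import Data.List.Relation.Binary.Subset.Propositional.Properties
  using (Any-resp-⊆; ⊆-trans; filter-⊆; xs⊆x∷xs)
  renaming (map⁺ to ⊆-map⁺)
open import Data.Product using (_×_; Σ-syntax; ∃-syntax; _,_; proj₂)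
open import Data.Sum using (_⊎_; inj₁; inj₂; [_,_]′)
open import Data.Empty using (⊥-elim)
open import Function using (_∘_; id)
open import Relation.Nullary using (yes; no)
open import Relation.Binary.PropositionalEquality
  using (_≡_; _≢_; refl; sym; trans; subst; cong₂; module ≡-Reasoning)

open import Algebra.Properties.CommutativeSemigroup
  (CommutativeMonoid.commutativeSemigroup ∨-commutativeMonoid)
  using (x∙yz≈y∙xz; x∙yz≈yx∙z)

disjoint-⋃ : ∀ {n} {p : Subset n} {qs : List (Subset n)} →
  All (λ q → p ∩ q ≡ ∅) qs → p ∩ ⋃ qs ≡ ∅
disjoint-⋃ {p = p} [] = ∩-zeroʳ p
disjoint-⋃ {p = p} {q ∷ qs} (p∩q≡∅ ∷ p∩qs≡∅) = begin
  p ∩ (q ∪ ⋃ qs)         ≡⟨ ∩-distribˡ-∪ p q (⋃ qs) ⟩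
  (p ∩ q) ∪ (p ∩ ⋃ qs)   ≡⟨ cong₂ _∪_ p∩q≡∅ (disjoint-⋃ p∩qs≡∅) ⟩
  ∅ ∪ ∅                  ≡⟨ ∪-identityʳ ∅ ⟩
  ∅                      ∎
  where open ≡-Reasoning

AllPairs-restrict : ∀ {A : Set} {P : A → Set} {R : A → A → Set} {xs} →
  All P xs → AllPairs (λ x y → P x → P y → R x y) xs → AllPairs R xs
AllPairs-restrict []         []         = []
AllPairs-restrict (px ∷ pxs) (rx ∷ rxs) =
  All.zipWith (λ (rxy , py) → rxy px py) (rx , pxs) ∷ AllPairs-restrict pxs rxs

x∈p∪q∧x∉q⇒x∈p : ∀ {n} {p q : Subset n} {x} → x ∈ p ∪ q → x ∉ q → x ∈ p
x∈p∪q∧x∉q⇒x∈p {p = p} {q} x∈p∪q x∉q = [ id , ⊥-elim ∘ x∉q ]′ (x∈p∪q⁻ p q x∈p∪q)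

module _ {m : ℕ} {S : Subset m} where

  ∈-members⁺ : ∀ {i} → i ∈ S → i ∈ₗ members S
  ∈-members⁺ = ∈-filter⁺ (_∈? S) (∈-allFin _)

  ∈-members⁻ : ∀ {i} → i ∈ₗ members S → i ∈ S
  ∈-members⁻ = proj₂ ∘ ∈-filter⁻ (_∈? S) {xs = allFin m}

  members-AllPairs : ∀ {R : Fin m → Fin m → Set} →
    (∀ {i j} → i ∈ S → j ∈ S → i ≢ j → R i j) → AllPairs R (members S)
  members-AllPairs R-distinct = AllPairs-restrict (All.all-filter (_∈? S) (allFin m))
    (AllPairs.filter⁺ (_∈? S) (AllPairs.tabulate⁺ λ i≢j i∈S j∈S → R-distinct i∈S j∈S i≢j))

module _ {AP : Set} {k : ℕ} where

  infix 4 _⊨_ _⇛_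

  _⊨_ : Val → Fm AP k → Set
  v ⊨ φ = eval v φ ≡ true

  -- A record, not a function type, so that φ and ψ can be inferred from φ ⇛ ψ.
  record _⇛_ (φ ψ : Fm AP k) : Set where
    constructor entails
    field satisfies : ∀ v → v ⊨ φ → v ⊨ ψ
  open _⇛_

  ⊢-⇛ : ∀ {φ ψ} → ⊢ φ → φ ⇛ ψ → ⊢ ψ
  ⊢-⇛ {φ} ⊢φ φ⇛ψ = R1 (φ ∷ []) (⊢φ ∷ []) λ { v (v⊨φ ∷ []) → satisfies φ⇛ψ v v⊨φ }

  eval-≡⇒⇛ : ∀ {φ ψ : Fm AP k} → (∀ v → eval v φ ≡ eval v ψ) → φ ⇛ ψ
  eval-≡⇒⇛ eval-≡ = entails λ v v⊨φ → trans (sym (eval-≡ v)) v⊨φ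

  ∨ᶠ-⊥-intro : ∀ {φ} → φ ⇛ φ ∨ᶠ ⊥ᶠ
  ∨ᶠ-⊥-intro {φ} = eval-≡⇒⇛ λ v → sym (∨-identityʳ (eval v φ))

  ∨ᶠ-⊥-elim : ∀ {φ} → φ ∨ᶠ ⊥ᶠ ⇛ φ
  ∨ᶠ-⊥-elim {φ} = eval-≡⇒⇛ λ v → ∨-identityʳ (eval v φ)

  x∨yz⇛y∨xz : ∀ {φ ψ χ} → φ ∨ᶠ (ψ ∨ᶠ χ) ⇛ ψ ∨ᶠ (φ ∨ᶠ χ)
  x∨yz⇛y∨xz {φ} {ψ} {χ} = eval-≡⇒⇛ λ v → x∙yz≈y∙xz (eval v φ) (eval v ψ) (eval v χ)

  x∨yz⇛yx∨z : ∀ {φ ψ χ} → φ ∨ᶠ (ψ ∨ᶠ χ) ⇛ (ψ ∨ᶠ φ) ∨ᶠ χ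
  x∨yz⇛yx∨z {φ} {ψ} {χ} = eval-≡⇒⇛ λ v → x∙yz≈yx∙z (eval v φ) (eval v ψ) (eval v χ)

  ⊨-∨⁺ : ∀ {v φ ψ} → v ⊨ φ ⊎ v ⊨ ψ → v ⊨ φ ∨ᶠ ψ
  ⊨-∨⁺ (inj₁ v⊨φ) rewrite v⊨φ = refl
  ⊨-∨⁺ {v} {φ} (inj₂ v⊨ψ) rewrite v⊨ψ = ∨-zeroʳ (eval v φ)

  ⊨-∨⁻ : ∀ {v φ ψ} → v ⊨ φ ∨ᶠ ψ → v ⊨ φ ⊎ v ⊨ ψ
  ⊨-∨⁻ {v} {φ} v⊨φ∨ψ with eval v φ
  ... | true  = inj₁ refl
  ... | false = inj₂ v⊨φ∨ψ

  ⊨-⋁⁺ : ∀ {v} Γ → Any (v ⊨_) Γ → v ⊨ ⋁ Γ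
  ⊨-⋁⁺ (_ ∷ [])    (here v⊨φ)  = v⊨φ
  ⊨-⋁⁺ (φ ∷ ψ ∷ Γ) (here v⊨φ)  = ⊨-∨⁺ {φ = φ} {⋁ (ψ ∷ Γ)} (inj₁ v⊨φ)
  ⊨-⋁⁺ (φ ∷ ψ ∷ Γ) (there v⊨Γ) = ⊨-∨⁺ {φ = φ} {⋁ (ψ ∷ Γ)} (inj₂ (⊨-⋁⁺ (ψ ∷ Γ) v⊨Γ))

  ⊨-⋁⁻ : ∀ {v} Γ → v ⊨ ⋁ Γ → Any (v ⊨_) Γ
  ⊨-⋁⁻ (_ ∷ [])    v⊨φ = here v⊨φ
  ⊨-⋁⁻ (φ ∷ ψ ∷ Γ) v⊨⋁ = [ here , there ∘ ⊨-⋁⁻ (ψ ∷ Γ) ]′ (⊨-∨⁻ {φ = φ} {⋁ (ψ ∷ Γ)} v⊨⋁)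

  ⊢-⋁-head : ∀ {φ} Γ → ⊢ φ → ⊢ (⋁ (φ ∷ Γ))
  ⊢-⋁-head {φ} Γ ⊢φ = ⊢-⇛ ⊢φ (entails λ v → ⊨-⋁⁺ (φ ∷ Γ) ∘ here)

  ⋁-⊆ : ∀ {Γ Δ} → Γ ⊆ Δ → ⋁ Γ ⇛ ⋁ Δ
  ⋁-⊆ {Γ} {Δ} Γ⊆Δ = entails λ v → ⊨-⋁⁺ Δ ∘ Any-resp-⊆ Γ⊆Δ ∘ ⊨-⋁⁻ Γ

  ⊨-⋁-map⁺ : ∀ {I : Set} {v} {g : I → Fm AP k} {i is} → i ∈ₗ is → v ⊨ g i → v ⊨ ⋁ (map g is)
  ⊨-⋁-map⁺ {g = g} {is = is} i∈is v⊨gi = ⊨-⋁⁺ (map g is) (Any.map⁺ (lose i∈is v⊨gi))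

  module Splitting {I : Set} (C : I → Coalition k) (f t : I → Fm AP k)
    (⊢-upgrade : ∀ {i χ} → ⊢ (Cd (C i) (f i) ∅ ⊥ᶠ ∨ᶠ χ) → ⊢ (t i ∨ᶠ χ)) where

    Separated : I → I → Set
    Separated i j = C i ∩ C j ≡ ∅

    ⊢-split-∨ : ∀ x xs {χ} → AllPairs Separated (x ∷ xs) →
      ⊢ (Cd (⋃ (map C (x ∷ xs))) (⋁ (map f (x ∷ xs))) ∅ ⊥ᶠ ∨ᶠ χ) →
      ⊢ (⋁ (map t (x ∷ xs)) ∨ᶠ χ)
    ⊢-split-∨ x [] {χ} _ ⊢Cd =
      ⊢-upgrade (subst (λ D → ⊢ (Cd D (f x) ∅ ⊥ᶠ ∨ᶠ χ)) (∪-identityʳ (C x)) ⊢Cd)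
    ⊢-split-∨ x (y ∷ ys) {χ} (x#ys ∷ ys#) ⊢Cd = ⊢-⇛ ⊢ts∨x∨χ x∨yz⇛yx∨z
      where
      rest : Fm AP k
      rest = Cd (⋃ (map C (y ∷ ys))) (⋁ (map f (y ∷ ys))) ∅ ⊥ᶠ

      ⊢x∨rest∨χ : ⊢ (t x ∨ᶠ rest ∨ᶠ χ)
      ⊢x∨rest∨χ = ⊢-upgrade (R3 (disjoint-⋃ (All.map⁺ x#ys)) ⊢Cd)

      ⊢ts∨x∨χ : ⊢ (⋁ (map t (y ∷ ys)) ∨ᶠ t x ∨ᶠ χ)
      ⊢ts∨x∨χ = ⊢-split-∨ y ys ys# (⊢-⇛ ⊢x∨rest∨χ x∨yz⇛y∨xz)

    ⊢-split : ∀ {xs} → AllPairs Separated xs → ⊢ (⋁ (map f xs)) → ⊢ (⋁ (map t xs))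
    ⊢-split {[]}     _         ⊢⊥ = ⊢⊥
    ⊢-split {x ∷ xs} separated ⊢f =
      ⊢-⇛ (⊢-split-∨ x xs separated (⊢-⇛ (R2 ⊢f) ∨ᶠ-⊥-intro)) ∨ᶠ-⊥-elim

  module Merge {m : ℕ} (A B : Fin m → Coalition k) (φ ψ : Fin m → Fm AP k) (NI₂ : Subset m) where

    coalition : Fin m → Coalition k
    coalition i with i ∈? NI₂
    ... | yes _ = A i ∪ B i
    ... | no  _ = A i

    claim : Fin m → Fm AP k
    claim i with i ∈? NI₂
    ... | yes _ = φ i ∨ᶠ ψ i
    ... | no  _ = φ i

    ⊢-upgrade : ∀ {i χ} → ⊢ (Cd (coalition i) (claim i) ∅ ⊥ᶠ ∨ᶠ χ) →
      ⊢ (Cd (A i) (φ i) (B i) (ψ i) ∨ᶠ χ)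
    ⊢-upgrade {i} with i ∈? NI₂
    ... | yes _ = R5
    ... | no  _ = R4

    ⊨-claim-φ : ∀ {v i} → v ⊨ φ i → v ⊨ claim i
    ⊨-claim-φ {i = i} v⊨φ with i ∈? NI₂
    ... | yes _ = ⊨-∨⁺ {φ = φ i} {ψ i} (inj₁ v⊨φ)
    ... | no  _ = v⊨φ

    ⊨-claim-φ∨ψ : ∀ {v i} → i ∈ NI₂ → v ⊨ φ i ∨ᶠ ψ i → v ⊨ claim i
    ⊨-claim-φ∨ψ {i = i} i∈NI₂ v⊨φ∨ψ with i ∈? NI₂
    ... | yes _     = v⊨φ∨ψ
    ... | no  i∉NI₂ = ⊥-elim (i∉NI₂ i∈NI₂)

    given⇛claims : ∀ NI₁ →
      ⋁ (map φ (members NI₁) ++ map (λ i → φ i ∨ᶠ ψ i) (members NI₂)) ⇛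
      ⋁ (map claim (members (NI₁ ∪ NI₂)))
    given⇛claims NI₁ = entails λ v →
      [ from-NI₁ ∘ find ∘ Any.map⁻ , from-NI₂ ∘ find ∘ Any.map⁻ ]′
        ∘ Any.++⁻ (map φ (members NI₁)) ∘ ⊨-⋁⁻ _
      where
      from-NI₁ : ∀ {v} → ∃[ i ] i ∈ₗ members NI₁ × v ⊨ φ i →
        v ⊨ ⋁ (map claim (members (NI₁ ∪ NI₂)))
      from-NI₁ (i , i∈ , v⊨φ) =
        ⊨-⋁-map⁺ (∈-members⁺ (x∈p∪q⁺ (inj₁ (∈-members⁻ i∈)))) (⊨-claim-φ v⊨φ)

      from-NI₂ : ∀ {v} → ∃[ i ] i ∈ₗ members NI₂ × v ⊨ φ i ∨ᶠ ψ i →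
        v ⊨ ⋁ (map claim (members (NI₁ ∪ NI₂)))
      from-NI₂ (i , i∈ , v⊨φ∨ψ) =
        ⊨-⋁-map⁺ (∈-members⁺ (x∈p∪q⁺ (inj₂ (∈-members⁻ i∈))))
          (⊨-claim-φ∨ψ (∈-members⁻ i∈) v⊨φ∨ψ)

    coalitions-separated : ∀ {NI₁ i j} → Neat A B NI₁ NI₂ →
      i ∈ NI₁ ∪ NI₂ → j ∈ NI₁ ∪ NI₂ → i ≢ j → coalition i ∩ coalition j ≡ ∅
    coalitions-separated {i = i} {j} (sep₁ , sep₂ , sep₁₂) i∈ j∈ i≢j
      with i ∈? NI₂ | j ∈? NI₂
    ... | yes i∈₂ | yes j∈₂ = sep₂ i j i∈₂ j∈₂ i≢j
    ... | yes i∈₂ | no  j∉₂ =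
      trans (∩-comm (A i ∪ B i) (A j)) (sep₁₂ j i (x∈p∪q∧x∉q⇒x∈p j∈ j∉₂) i∈₂ (i≢j ∘ sym))
    ... | no  i∉₂ | yes j∈₂ = sep₁₂ i j (x∈p∪q∧x∉q⇒x∈p i∈ i∉₂) j∈₂ i≢j
    ... | no  i∉₂ | no  j∉₂ = sep₁ i j (x∈p∪q∧x∉q⇒x∈p i∈ i∉₂) (x∈p∪q∧x∉q⇒x∈p j∈ j∉₂) i≢j

mainTheorem15 : (AP : Set) (k : ℕ) (γ : List (Bool × AP)) (m : ℕ)
    (A B : Fin m → Coalition k) (φ ψ : Fin m → Fm AP k) →
    (⊢ (elemDisj {k = k} γ)
      ⊎ (Σ[ NI₁ ∈ Subset m ] Σ[ NI₂ ∈ Subset m ]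
           (Neat A B NI₁ NI₂ ×
            ⊢ (⋁ (map φ (members NI₁) ++ map (λ i → φ i ∨ᶠ ψ i) (members NI₂)))))) →
    ⊢ (⋁ (elemDisj γ ∷ map (λ i → Cd (A i) (φ i) (B i) (ψ i)) (allFin m)))
mainTheorem15 AP k γ m A B φ ψ (inj₁ ⊢γ) = ⊢-⋁-head (map _ (allFin m)) ⊢γ
mainTheorem15 AP k γ m A B φ ψ (inj₂ (NI₁ , NI₂ , neat , ⊢given)) =
  ⊢-⇛ (⊢-split (members-AllPairs (coalitions-separated neat)) (⊢-⇛ ⊢given (given⇛claims NI₁)))
      (⋁-⊆ (⊆-trans (⊆-map⁺ liability (filter-⊆ (_∈? (NI₁ ∪ NI₂)) (allFin m)))
                    (xs⊆x∷xs (map liability (allFin m)) (elemDisj γ))))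
  where
  liability : Fin m → Fm AP k
  liability i = Cd (A i) (φ i) (B i) (ψ i)

  open Merge A B φ ψ NI₂
  open Splitting coalition claim liability ⊢-upgrade
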